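{- Let $r$ and $s$ be non-negative integers with $r\ge 3s+8$. Then $F_v(2_r;r-s-2)\le r+2s+9$.
   Context: All graphs are finite, undirected, without loops or multiple edges. $\omega(G)$ is the clique number of $G$. $G\to^v(2_r)$ means that every partition of $V(G)$ into $r$ pairwise disjoint (possibly empty) classes has a class containing an edge, i.e. $\chi(G)\ge r+1$. $H_v(2_r;q)$ is the set of graphs $G$ with $G\to^v(2_r)$ and $\omega(G)<q$, and $F_v(2_r;q)=\min\{|V(G)|:G\in H_v(2_r;q)\}$ (it exists whenever $q\ge 3$). -}

module Defs where

open import Data.Nat using (ℕ; _<_; _≤_)
open import Data.Fin using (Fin)
open import Data.Bool using (Bool; true; false)
open import Data.Product using (Σ; ∃; ∃-syntax; _×_)
open import Relation.Binary.PropositionalEquality using (_≡_; _≢_)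

record Graph (n : ℕ) : Set where
  field
    adj   : Fin n → Fin n → Bool
    sym   : ∀ x y → adj x y ≡ adj y x
    irrefl : ∀ x → adj x x ≡ false
open Graph public

∣V∣ : ∀ {n} → Graph n → ℕ
∣V∣ {n} _ = n

-- A k-clique in G: k pairwise adjacent vertices, given as a map from Fin k
-- (distinct indices go to adjacent, hence distinct, vertices).
IsClique : ∀ {n k} → Graph n → (Fin k → Fin n) → Set
IsClique G f = ∀ i j → i ≢ j → adj G (f i) (f j) ≡ true

ω<_ : ∀ {n} → Graph n → ℕ → Set
ω<_ {n} G q = ∀ (k : ℕ) (f : Fin k → Fin n) → IsClique G f → k < q

-- G →v (2_r): every partition of V(G) into r (possibly empty) classes,
-- i.e. every map V(G) → Fin r, has a class containing an edge.
_→v2_ : ∀ {n} → Graph n → ℕ → Set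
_→v2_ {n} G r = ∀ (c : Fin n → Fin r) →
  ∃[ x ] ∃[ y ] (adj G x y ≡ true × c x ≡ c y)

InHv : ∀ {n} → Graph n → ℕ → ℕ → Set
InHv G r q = (G →v2 r) × (ω< G) q

-- F_v(2_r; q) ≤ N : since F_v(2_r;q) = min{|V(G)| : G ∈ H_v(2_r;q)},
-- this holds iff some G ∈ H_v(2_r;q) has |V(G)| ≤ N.
Fv≤ : ℕ → ℕ → ℕ → Set
Fv≤ r q N = ∃[ n ] (n ≤ N × Σ (Graph n) (λ G → InHv G r q))

module Submission where

-- Write r = 3s + 8 + t.  The witness is the join
--     G = R₁₇ + s·C₅ + t·K₁,
-- where R₁₇ is the complement of a triangle-free graph on 17 vertices
-- without independent 6-sets (a Ramsey (3,6)-graph), so χ(R₁₇) ≥ 9 and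
-- ω(R₁₇) ≤ 5.  In a join both χ and ω are additive, hence
--     χ(G) ≥ 9 + 3s + t = r + 1   and   ω(G) ≤ 5 + 2s + t < r - s - 2,
-- while |V(G)| = 17 + 5s + t = r + 2s + 9.

open import Defs
open import Data.Nat using (ℕ; _+_; _*_; _∸_; _≥_)
open import Data.Nat using (zero; suc; _≤_; _<_; z≤n; s≤s; _≡ᵇ_; ⌈_/2⌉)
import Data.Nat.Properties as ℕ
open import Data.Nat.Tactic.RingSolver using (solve-∀)
open import Data.Fin using (Fin; zero; suc; toℕ; _↑ˡ_; _↑ʳ_; splitAt; join; punchIn; inject≤; lift)
import Data.Fin.Properties as FinP
open import Data.Bool using (Bool; true; false; not; _∧_; _∨_)
import Data.Bool.Properties as BoolP
open import Data.Sum using (_⊎_; inj₁; inj₂; [_,_])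
open import Data.Product using (Σ; ∃; _×_; _,_; proj₁; proj₂)
open import Data.List using (List; []; _∷_; allFin; filter)
open import Data.Bool.ListAction using (any)
open import Data.List.Relation.Unary.Any using (here; there)
open import Data.List.Membership.Propositional using (_∈_)
open import Data.List.Membership.Propositional.Properties using (∈-allFin; ∈-filter⁺)
import Data.Vec.Functional as Vector
open import Data.Empty using (⊥; ⊥-elim)
open import Function using (_∘_; mk⇔)
open import Function.Definitions using (Injective)
open import Relation.Nullary using (Dec; yes; no; does; contradiction)
open import Relation.Nullary.Decidable using (_×-dec_; dec-true; dec-false; does-⇔)
open import Relation.Binary.PropositionalEquality
  using (_≡_; _≢_; refl; trans; cong; cong₂; subst; subst₂; module ≡-Reasoning)
  renaming (sym to ≡-sym)

ω≤ : ∀ {n} → Graph n → ℕ → Set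
ω≤ {n} G a = ∀ k (f : Fin k → Fin n) → IsClique G f → k ≤ a

Proper : ∀ {n r} → Graph n → (Fin n → Fin r) → Set
Proper G c = ∀ x y → adj G x y ≡ true → c x ≢ c y

Rainbow : ∀ {n r} → (Fin n → Fin r) → ℕ → Set
Rainbow {n} c k = Σ (Fin k → Fin n) λ h → Injective _≡_ _≡_ (c ∘ h)

-- χ(G) ≥ k, in a constructive form: every proper colouring (with any
-- number of colours) exhibits a rainbow k-set.
χ≥ : ∀ {n} → Graph n → ℕ → Set
χ≥ {n} G k = ∀ {r} (c : Fin n → Fin r) → Proper G c → Rainbow c k

-- If χ(G) > r, every r-colouring has a monochromatic edge (pigeonhole on
-- the rainbow set of a hypothetical proper colouring).
χ≥⇒→v2 : ∀ {n r k} (G : Graph n) → χ≥ G k → r < k → G →v2 r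
χ≥⇒→v2 G χG r<k c
  with FinP.any? (λ x → FinP.any? (λ y → (adj G x y BoolP.≟ true) ×-dec (c x FinP.≟ c y)))
... | yes monochromatic = monochromatic
... | no none =
  let (h , rainbow) = χG c (λ x y xy cxy → none (x , y , xy , cxy))
      (i , j , i<j , same) = FinP.pigeonhole r<k (c ∘ h)
  in contradiction (rainbow same) (FinP.<⇒≢ i<j)

ω≤⇒ω< : ∀ {n a q} (G : Graph n) → ω≤ G a → a < q → (ω< G) q
ω≤⇒ω< G ωG a<q k f clique = ℕ.≤-<-trans (ωG k f clique) a<q

-- Cliques consist of distinct vertices, because the graph has no loops.
clique-injective : ∀ {n k} (G : Graph n) {f : Fin k → Fin n} → IsClique G f → Injective _≡_ _≡_ f
clique-injective G {f} clique {i} {j} fi≡fj with i FinP.≟ j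
... | yes i≡j = i≡j
... | no i≢j = contradiction (trans (≡-sym (clique i j i≢j)) loop) λ ()
  where
  loop : adj G (f i) (f j) ≡ false
  loop = subst (λ y → adj G (f i) y ≡ false) fi≡fj (irrefl G (f i))

clique-∘ : ∀ {n k j} (G : Graph n) {f : Fin k → Fin n} {g : Fin j → Fin k} →
           IsClique G f → Injective _≡_ _≡_ g → IsClique G (f ∘ g)
clique-∘ G clique g-injective a b a≢b = clique _ _ (a≢b ∘ g-injective)

-- A verified clique-freeness checker.

IsCliqueOf : ∀ {m d} → (Fin m → Fin m → Bool) → (Fin d → Fin m) → Set
IsCliqueOf A f = Injective _≡_ _≡_ f × (∀ i j → i ≢ j → A (f i) (f j) ≡ true)

-- cliqueFree A d cs = true certifies that cs contains no d-clique of A: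
-- a d-clique either avoids the head v, or consists of v and a (d-1)-clique
-- among the A-neighbours of v.
cliqueFree : ∀ {m} → (Fin m → Fin m → Bool) → ℕ → List (Fin m) → Bool
cliqueFree A zero    cs       = false
cliqueFree A (suc d) []       = true
cliqueFree A (suc d) (v ∷ cs) =
  cliqueFree A d (filter (λ w → A v w BoolP.≟ true) cs) ∧ cliqueFree A (suc d) cs

mutual
  cliqueFree-sound : ∀ {m} (A : Fin m → Fin m → Bool) d cs → cliqueFree A d cs ≡ true →
                     (f : Fin d → Fin m) → IsCliqueOf A f → (∀ i → f i ∈ cs) → ⊥
  cliqueFree-sound A zero    cs () f clique inside
  cliqueFree-sound A (suc d) cs ok f clique inside = cliqueFree-sound⁺ A d cs ok f clique inside

  cliqueFree-sound⁺ : ∀ {m} (A : Fin m → Fin m → Bool) d cs → cliqueFree A (suc d) cs ≡ true →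
                      (f : Fin (suc d) → Fin m) → IsCliqueOf A f → (∀ i → f i ∈ cs) → ⊥
  cliqueFree-sound⁺ A d [] ok f clique inside with inside zero
  ... | ()
  cliqueFree-sound⁺ A d (v ∷ cs) ok f (f-injective , related) inside =
    byHead (FinP.any? (λ i → f i FinP.≟ v))
    where
    byHead : Dec (∃ λ i → f i ≡ v) → ⊥
    byHead (yes (i , fi≡v)) =
      cliqueFree-sound A d _ (BoolP.∧-conicalˡ _ _ ok) (f ∘ punchIn i) (rest-injective , rest-related) rest-inside
      where
      rest-injective : Injective _≡_ _≡_ (f ∘ punchIn i)
      rest-injective = FinP.punchIn-injective i _ _ ∘ f-injective
      rest-related : ∀ a b → a ≢ b → A (f (punchIn i a)) (f (punchIn i b)) ≡ true
      rest-related a b a≢b = related _ _ (a≢b ∘ FinP.punchIn-injective i a b)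
      rest-inside : ∀ a → f (punchIn i a) ∈ filter (λ w → A v w BoolP.≟ true) cs
      rest-inside a with inside (punchIn i a)
      ... | here is-v = contradiction (f-injective (trans is-v (≡-sym fi≡v))) (FinP.punchInᵢ≢i i a)
      ... | there in-cs = ∈-filter⁺ (λ w → A v w BoolP.≟ true) in-cs
            (subst (λ u → A u (f (punchIn i a)) ≡ true) fi≡v
              (related i (punchIn i a) (FinP.punchInᵢ≢i i a ∘ ≡-sym)))
    byHead (no v-unused) =
      cliqueFree-sound⁺ A d cs (BoolP.∧-conicalʳ _ _ ok) f (f-injective , related) inside-cs
      where
      inside-cs : ∀ i → f i ∈ cs
      inside-cs i with inside i
      ... | here is-v = contradiction (i , is-v) v-unused
      ... | there in-cs = in-cs

ω≤-by-check : ∀ {n} (G : Graph n) a → cliqueFree (adj G) (suc a) (allFin n) ≡ true → ω≤ G a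
ω≤-by-check {n} G a ok k f clique with k ℕ.≤? a
... | yes k≤a = k≤a
... | no k≰a = ⊥-elim (cliqueFree-sound (adj G) (suc a) (allFin n) ok g
                         (clique-injective G g-clique , g-clique) (λ i → ∈-allFin (g i)))
  where
  a<k : a < k
  a<k = ℕ.≰⇒> k≰a
  g : Fin (suc a) → Fin n
  g i = f (inject≤ i a<k)
  g-clique : IsClique G g
  g-clique = clique-∘ G clique (FinP.inject≤-injective a<k a<k _ _)

-- The join G₁ + G₂: disjoint union plus all edges between the two parts.

joinRel : ∀ {n₁ n₂} → Graph n₁ → Graph n₂ → Fin n₁ ⊎ Fin n₂ → Fin n₁ ⊎ Fin n₂ → Bool
joinRel G₁ G₂ (inj₁ x) (inj₁ y) = adj G₁ x y
joinRel G₁ G₂ (inj₂ x) (inj₂ y) = adj G₂ x y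
joinRel G₁ G₂ (inj₁ _) (inj₂ _) = true
joinRel G₁ G₂ (inj₂ _) (inj₁ _) = true

joinRel-sym : ∀ {n₁ n₂} (G₁ : Graph n₁) (G₂ : Graph n₂) u v → joinRel G₁ G₂ u v ≡ joinRel G₁ G₂ v u
joinRel-sym G₁ G₂ (inj₁ x) (inj₁ y) = sym G₁ x y
joinRel-sym G₁ G₂ (inj₂ x) (inj₂ y) = sym G₂ x y
joinRel-sym G₁ G₂ (inj₁ _) (inj₂ _) = refl
joinRel-sym G₁ G₂ (inj₂ _) (inj₁ _) = refl

joinRel-irrefl : ∀ {n₁ n₂} (G₁ : Graph n₁) (G₂ : Graph n₂) u → joinRel G₁ G₂ u u ≡ false
joinRel-irrefl G₁ G₂ (inj₁ x) = irrefl G₁ x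
joinRel-irrefl G₁ G₂ (inj₂ x) = irrefl G₂ x

infixr 5 _⊕_
_⊕_ : ∀ {n₁ n₂} → Graph n₁ → Graph n₂ → Graph (n₁ + n₂)
_⊕_ {n₁} G₁ G₂ = record
  { adj    = λ x y → joinRel G₁ G₂ (splitAt n₁ x) (splitAt n₁ y)
  ; sym    = λ x y → joinRel-sym G₁ G₂ (splitAt n₁ x) (splitAt n₁ y)
  ; irrefl = λ x → joinRel-irrefl G₁ G₂ (splitAt n₁ x)
  }

adj-↑ˡ : ∀ {n₁ n₂} (G₁ : Graph n₁) (G₂ : Graph n₂) x y →
         adj (G₁ ⊕ G₂) (x ↑ˡ n₂) (y ↑ˡ n₂) ≡ adj G₁ x y
adj-↑ˡ {n₁} {n₂} G₁ G₂ x y rewrite FinP.splitAt-↑ˡ n₁ x n₂ | FinP.splitAt-↑ˡ n₁ y n₂ = refl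

adj-↑ʳ : ∀ {n₁ n₂} (G₁ : Graph n₁) (G₂ : Graph n₂) x y →
         adj (G₁ ⊕ G₂) (n₁ ↑ʳ x) (n₁ ↑ʳ y) ≡ adj G₂ x y
adj-↑ʳ {n₁} {n₂} G₁ G₂ x y rewrite FinP.splitAt-↑ʳ n₁ n₂ x | FinP.splitAt-↑ʳ n₁ n₂ y = refl

adj-↑ˡ↑ʳ : ∀ {n₁ n₂} (G₁ : Graph n₁) (G₂ : Graph n₂) x y →
           adj (G₁ ⊕ G₂) (x ↑ˡ n₂) (n₁ ↑ʳ y) ≡ true
adj-↑ˡ↑ʳ {n₁} {n₂} G₁ G₂ x y rewrite FinP.splitAt-↑ˡ n₁ x n₂ | FinP.splitAt-↑ʳ n₁ n₂ y = refl

splitAt-injective : ∀ m {n} {i j : Fin (m + n)} → splitAt m i ≡ splitAt m j → i ≡ j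
splitAt-injective m {n} {i} {j} eq = begin
  i                     ≡⟨ ≡-sym (FinP.join-splitAt m n i) ⟩
  join m n (splitAt m i) ≡⟨ cong (join m n) eq ⟩
  join m n (splitAt m j) ≡⟨ FinP.join-splitAt m n j ⟩
  j                     ∎
  where open ≡-Reasoning

rainbow-++ : ∀ {n₁ n₂ r k₁ k₂} (c : Fin (n₁ + n₂) → Fin r) →
             (∀ x y → c (x ↑ˡ n₂) ≢ c (n₁ ↑ʳ y)) →
             Rainbow (c ∘ (_↑ˡ n₂)) k₁ → Rainbow (c ∘ (n₁ ↑ʳ_)) k₂ → Rainbow c (k₁ + k₂)
rainbow-++ {n₁} {n₂} {k₁ = k₁} {k₂} c apart (h₁ , rainbow₁) (h₂ , rainbow₂) =
  h ∘ splitAt k₁ , splitAt-injective k₁ ∘ h-rainbow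
  where
  h : Fin k₁ ⊎ Fin k₂ → Fin (n₁ + n₂)
  h = [ (_↑ˡ n₂) ∘ h₁ , (n₁ ↑ʳ_) ∘ h₂ ]
  h-rainbow : ∀ {u v} → c (h u) ≡ c (h v) → u ≡ v
  h-rainbow {inj₁ a} {inj₁ b} eq = cong inj₁ (rainbow₁ eq)
  h-rainbow {inj₂ a} {inj₂ b} eq = cong inj₂ (rainbow₂ eq)
  h-rainbow {inj₁ a} {inj₂ b} eq = contradiction eq (apart (h₁ a) (h₂ b))
  h-rainbow {inj₂ a} {inj₁ b} eq = contradiction (≡-sym eq) (apart (h₁ b) (h₂ a))

-- χ is additive under joins: the two parts of a proper colouring of the
-- join are proper and use disjoint colour sets.
χ≥-join : ∀ {n₁ n₂ k₁ k₂} (G₁ : Graph n₁) (G₂ : Graph n₂) →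
          χ≥ G₁ k₁ → χ≥ G₂ k₂ → χ≥ (G₁ ⊕ G₂) (k₁ + k₂)
χ≥-join {n₁} {n₂} G₁ G₂ χ₁ χ₂ c proper =
  rainbow-++ c (λ x y → proper _ _ (adj-↑ˡ↑ʳ G₁ G₂ x y)) (χ₁ _ proper₁) (χ₂ _ proper₂)
  where
  proper₁ : Proper G₁ (c ∘ (_↑ˡ n₂))
  proper₁ x y xy = proper _ _ (trans (adj-↑ˡ G₁ G₂ x y) xy)
  proper₂ : Proper G₂ (c ∘ (n₁ ↑ʳ_))
  proper₂ x y xy = proper _ _ (trans (adj-↑ʳ G₁ G₂ x y) xy)

record SumSplit {A B : Set} {k} (f : Fin k → A ⊎ B) : Set where
  field
    kˡ kʳ        : ℕ
    size         : k ≡ kˡ + kʳ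
    ιˡ           : Fin kˡ → Fin k
    ιˡ-injective : Injective _≡_ _≡_ ιˡ
    fˡ           : Fin kˡ → A
    fˡ-spec      : ∀ a → f (ιˡ a) ≡ inj₁ (fˡ a)
    ιʳ           : Fin kʳ → Fin k
    ιʳ-injective : Injective _≡_ _≡_ ιʳ
    fʳ           : Fin kʳ → B
    fʳ-spec      : ∀ b → f (ιʳ b) ≡ inj₂ (fʳ b)

sumSplit : ∀ {A B : Set} {k} (f : Fin k → A ⊎ B) → SumSplit f
sumSplit {k = zero} f = record
  { kˡ = 0 ; kʳ = 0 ; size = refl
  ; ιˡ = λ () ; ιˡ-injective = λ { {()} } ; fˡ = λ () ; fˡ-spec = λ ()
  ; ιʳ = λ () ; ιʳ-injective = λ { {()} } ; fʳ = λ () ; fʳ-spec = λ () }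
sumSplit {k = suc k} f with sumSplit (f ∘ suc) | f zero in f₀
... | S | inj₁ a = record
  { kˡ = suc kˡ ; kʳ = kʳ ; size = cong suc size
  ; ιˡ = lift 1 ιˡ ; ιˡ-injective = FinP.lift-injective ιˡ ιˡ-injective 1
  ; fˡ = a Vector.∷ fˡ ; fˡ-spec = λ { zero → f₀ ; (suc i) → fˡ-spec i }
  ; ιʳ = suc ∘ ιʳ ; ιʳ-injective = ιʳ-injective ∘ FinP.suc-injective
  ; fʳ = fʳ ; fʳ-spec = fʳ-spec }
  where open SumSplit S
... | S | inj₂ b = record
  { kˡ = kˡ ; kʳ = suc kʳ ; size = trans (cong suc size) (≡-sym (ℕ.+-suc kˡ kʳ))
  ; ιˡ = suc ∘ ιˡ ; ιˡ-injective = ιˡ-injective ∘ FinP.suc-injective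
  ; fˡ = fˡ ; fˡ-spec = fˡ-spec
  ; ιʳ = lift 1 ιʳ ; ιʳ-injective = FinP.lift-injective ιʳ ιʳ-injective 1
  ; fʳ = b Vector.∷ fʳ ; fʳ-spec = λ { zero → f₀ ; (suc i) → fʳ-spec i } }
  where open SumSplit S

-- ω is additive under joins: a clique of the join splits into a clique of
-- each part.
ω≤-join : ∀ {n₁ n₂ a₁ a₂} (G₁ : Graph n₁) (G₂ : Graph n₂) →
          ω≤ G₁ a₁ → ω≤ G₂ a₂ → ω≤ (G₁ ⊕ G₂) (a₁ + a₂)
ω≤-join {n₁} G₁ G₂ ω₁ ω₂ k f clique =
  subst (_≤ _) (≡-sym size) (ℕ.+-mono-≤ (ω₁ kˡ fˡ cliqueˡ) (ω₂ kʳ fʳ cliqueʳ))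
  where
  open SumSplit (sumSplit (splitAt n₁ ∘ f))
  cliqueˡ : IsClique G₁ fˡ
  cliqueˡ i j i≢j = subst₂ (λ u v → joinRel G₁ G₂ u v ≡ true) (fˡ-spec i) (fˡ-spec j)
                      (clique (ιˡ i) (ιˡ j) (i≢j ∘ ιˡ-injective))
  cliqueʳ : IsClique G₂ fʳ
  cliqueʳ i j i≢j = subst₂ (λ u v → joinRel G₁ G₂ u v ≡ true) (fʳ-spec i) (fʳ-spec j)
                      (clique (ιʳ i) (ιʳ j) (i≢j ∘ ιʳ-injective))

emptyGraph : Graph 0
emptyGraph = record { adj = λ () ; sym = λ () ; irrefl = λ () }

χ≥-empty : χ≥ emptyGraph 0
χ≥-empty c proper = (λ ()) , λ { {()} }

ω≤-empty : ω≤ emptyGraph 0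
ω≤-empty zero    f clique = z≤n
ω≤-empty (suc k) f clique with f zero
... | ()

infixr 6 _⊗_
_⊗_ : ∀ {m} (s : ℕ) → Graph m → Graph (s * m)
zero  ⊗ G = emptyGraph
suc s ⊗ G = G ⊕ (s ⊗ G)

χ≥-⊗ : ∀ {m k} s (G : Graph m) → χ≥ G k → χ≥ (s ⊗ G) (s * k)
χ≥-⊗ zero    G χG = χ≥-empty
χ≥-⊗ (suc s) G χG = χ≥-join G (s ⊗ G) χG (χ≥-⊗ s G χG)

ω≤-⊗ : ∀ {m a} s (G : Graph m) → ω≤ G a → ω≤ (s ⊗ G) (s * a)
ω≤-⊗ zero    G ωG = ω≤-empty
ω≤-⊗ (suc s) G ωG = ω≤-join G (s ⊗ G) ωG (ω≤-⊗ s G ωG)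

AtMostTwoPerColour : ∀ {m r} → (Fin m → Fin r) → Set
AtMostTwoPerColour c = ∀ {x y z} → x ≢ y → y ≢ z → x ≢ z → c x ≡ c y → c y ≡ c z → ⊥

atMostTwo-∘ : ∀ {m m′ r} {c : Fin m → Fin r} (g : Fin m′ → Fin m) →
              Injective _≡_ _≡_ g → AtMostTwoPerColour c → AtMostTwoPerColour (c ∘ g)
atMostTwo-∘ g g-injective two x≢y y≢z x≢z =
  two (x≢y ∘ g-injective) (y≢z ∘ g-injective) (x≢z ∘ g-injective)

rainbow-∘ : ∀ {m m′ r k} {c : Fin m → Fin r} (g : Fin m′ → Fin m) → Rainbow (c ∘ g) k → Rainbow c k
rainbow-∘ g R = g ∘ proj₁ R , proj₂ R

rainbow-cons : ∀ {m r k} {c : Fin m → Fin r} (v : Fin m) (R : Rainbow c k) →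
               (∀ i → c (proj₁ R i) ≢ c v) → Rainbow c (suc k)
rainbow-cons {c = c} v (h , rainbow) fresh = v Vector.∷ h , extended
  where
  extended : Injective _≡_ _≡_ (c ∘ (v Vector.∷ h))
  extended {zero}  {zero}  _  = refl
  extended {zero}  {suc j} eq = contradiction (≡-sym eq) (fresh j)
  extended {suc i} {zero}  eq = contradiction eq (fresh i)
  extended {suc i} {suc j} eq = cong suc (rainbow eq)

rainbow-shrink : ∀ {m r j k} {c : Fin m → Fin r} → Rainbow c k → j ≤ k → Rainbow c j
rainbow-shrink (h , rainbow) j≤k =
  (λ i → h (inject≤ i j≤k)) , FinP.inject≤-injective j≤k j≤k _ _ ∘ rainbow

-- The vertices of Fin (2 + m) other than 0 and 1 + j.
skip : ∀ {m} → Fin (suc m) → Fin m → Fin (suc (suc m))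
skip j = suc ∘ punchIn j

skip-injective : ∀ {m} (j : Fin (suc m)) → Injective _≡_ _≡_ (skip j)
skip-injective j = FinP.punchIn-injective j _ _ ∘ FinP.suc-injective

-- If the colour of vertex 0 is unique,
-- add 0 to a rainbow set of the other vertices; if it is shared with a
-- partner 1 + j, then (no colour being used three times) 0 extends any
-- rainbow set avoiding both 0 and its partner.
rainbow-step : ∀ {m r} (c : Fin (suc (suc m)) → Fin r) → AtMostTwoPerColour c →
               Rainbow (c ∘ suc) ⌈ suc m /2⌉ → (∀ j → Rainbow (c ∘ skip j) ⌈ m /2⌉) →
               Rainbow c ⌈ suc (suc m) /2⌉
rainbow-step {m} c two others without with FinP.any? (λ j → c (suc j) FinP.≟ c zero)
... | no unique =
  rainbow-shrink {c = c} (rainbow-cons {c = c} zero (rainbow-∘ {c = c} suc others) fresh)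
                 (s≤s (ℕ.⌈n/2⌉-mono (ℕ.n≤1+n m)))
  where
  fresh : ∀ i → c (suc (proj₁ others i)) ≢ c zero
  fresh i same = unique (proj₁ others i , same)
... | yes (j , partner) = rainbow-cons {c = c} zero (rainbow-∘ {c = c} (skip j) (without j)) third
  where
  third : ∀ i → c (skip j (proj₁ (without j) i)) ≢ c zero
  third i same = two (λ ()) (λ ()) (FinP.punchInᵢ≢i j _ ∘ ≡-sym ∘ FinP.suc-injective)
                     partner (≡-sym same)

rainbow-half : ∀ m {r} (c : Fin m → Fin r) → AtMostTwoPerColour c → Rainbow c ⌈ m /2⌉
rainbow-half zero          c two = (λ ()) , λ { {()} }
rainbow-half (suc zero)    c two = (λ _ → zero) , λ { {zero} {zero} _ → refl }
rainbow-half (suc (suc m)) c two = rainbow-step c two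
  (rainbow-half (suc m) (c ∘ suc) (atMostTwo-∘ suc FinP.suc-injective two))
  (λ j → rainbow-half m (c ∘ skip j) (atMostTwo-∘ (skip j) (skip-injective j) two))

-- Complements of triangle-free graphs.

complementOf : ∀ {n} → (Fin n → Fin n → Bool) → Graph n
complementOf H = record
  { adj    = λ x y → not (does (x FinP.≟ y)) ∧ not (H x y ∨ H y x)
  ; sym    = λ x y → cong₂ (λ u v → not u ∧ not v)
                       (does-⇔ (mk⇔ ≡-sym ≡-sym) (x FinP.≟ y) (y FinP.≟ x)) (BoolP.∨-comm (H x y) (H y x))
  ; irrefl = λ x → cong (λ u → not u ∧ not (H x x ∨ H x x)) (dec-true (x FinP.≟ x) refl)
  }

complement-nonadj : ∀ {n} (H : Fin n → Fin n → Bool) x y → x ≢ y →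
                    adj (complementOf H) x y ≡ false → (H x y ∨ H y x) ≡ true
complement-nonadj H x y x≢y nonadj rewrite dec-false (x FinP.≟ y) x≢y = BoolP.not-injective nonadj

-- If the symmetric closure of H is triangle-free, the complement has no
-- independent triple, so each colour class of a proper colouring has at
-- most two vertices and χ ≥ ⌈n/2⌉.
χ≥-complement : ∀ {n} (H : Fin n → Fin n → Bool) →
                cliqueFree (λ x y → H x y ∨ H y x) 3 (allFin n) ≡ true →
                χ≥ (complementOf H) ⌈ n /2⌉
χ≥-complement {n} H triangleFree c proper = rainbow-half n c atMostTwo
  where
  related : ∀ x y → x ≢ y → c x ≡ c y → (H x y ∨ H y x) ≡ true
  related x y x≢y same = complement-nonadj H x y x≢y (BoolP.¬-not (λ xy → proper x y xy same))
  atMostTwo : AtMostTwoPerColour c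
  atMostTwo {x} {y} {z} x≢y y≢z x≢z cx≡cy cy≡cz =
    cliqueFree-sound _ 3 (allFin n) triangleFree triple (distinct , pairwiseRelated) (λ i → ∈-allFin (triple i))
    where
    triple : Fin 3 → Fin n
    triple zero             = x
    triple (suc zero)       = y
    triple (suc (suc zero)) = z
    distinct : Injective _≡_ _≡_ triple
    distinct {zero}           {zero}           _  = refl
    distinct {suc zero}       {suc zero}       _  = refl
    distinct {suc (suc zero)} {suc (suc zero)} _  = refl
    distinct {zero}           {suc zero}       eq = contradiction eq x≢y
    distinct {zero}           {suc (suc zero)} eq = contradiction eq x≢z
    distinct {suc zero}       {zero}           eq = contradiction (≡-sym eq) x≢y
    distinct {suc zero}       {suc (suc zero)} eq = contradiction eq y≢z
    distinct {suc (suc zero)} {zero}           eq = contradiction (≡-sym eq) x≢z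
    distinct {suc (suc zero)} {suc zero}       eq = contradiction (≡-sym eq) y≢z
    colour : ∀ i → c (triple i) ≡ c y
    colour zero             = cx≡cy
    colour (suc zero)       = refl
    colour (suc (suc zero)) = ≡-sym cy≡cz
    pairwiseRelated : ∀ i j → i ≢ j → (H (triple i) (triple j) ∨ H (triple j) (triple i)) ≡ true
    pairwiseRelated i j i≢j = related _ _ (i≢j ∘ distinct) (trans (colour i) (≡-sym (colour j)))

edgesOf : ∀ {n} → (ℕ → List ℕ) → Fin n → Fin n → Bool
edgesOf neighbours x y = any (toℕ y ≡ᵇ_) (neighbours (toℕ x))

complement : (n : ℕ) → (ℕ → List ℕ) → Graph n
complement n neighbours = complementOf (edgesOf neighbours)

K₁ : Graph 1
K₁ = complement 1 (λ _ → [])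

cycle₅ : ℕ → List ℕ
cycle₅ 0 = 1 ∷ 4 ∷ []
cycle₅ 1 = 2 ∷ []
cycle₅ 2 = 3 ∷ []
cycle₅ 3 = 4 ∷ []
cycle₅ _ = []

C₅ : Graph 5
C₅ = complement 5 cycle₅

-- R₁₇ = complement of a triangle-free graph on 17 vertices without
-- independent 6-sets.
ramsey₃₆ : ℕ → List ℕ
ramsey₃₆ 0  = 6 ∷ 8 ∷ 9 ∷ 12 ∷ 15 ∷ []
ramsey₃₆ 1  = 5 ∷ 10 ∷ 11 ∷ 12 ∷ 15 ∷ []
ramsey₃₆ 2  = 9 ∷ 11 ∷ 14 ∷ 16 ∷ []
ramsey₃₆ 3  = 4 ∷ 8 ∷ 10 ∷ 14 ∷ 15 ∷ []
ramsey₃₆ 4  = 5 ∷ 11 ∷ 12 ∷ 16 ∷ []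
ramsey₃₆ 5  = 8 ∷ 9 ∷ 14 ∷ []
ramsey₃₆ 6  = 7 ∷ 10 ∷ 14 ∷ 16 ∷ []
ramsey₃₆ 7  = 9 ∷ 11 ∷ 13 ∷ 15 ∷ []
ramsey₃₆ 8  = 11 ∷ 13 ∷ []
ramsey₃₆ 9  = 10 ∷ []
ramsey₃₆ 10 = 13 ∷ []
ramsey₃₆ 12 = 13 ∷ 14 ∷ []
ramsey₃₆ 13 = 16 ∷ []
ramsey₃₆ 15 = 16 ∷ []
ramsey₃₆ _  = []

R₁₇ : Graph 17
R₁₇ = complement 17 ramsey₃₆

-- The colouring bounds follow from χ≥-complement and the clique bounds from
-- ω≤-by-check, the required checks being decided by evaluation.
χ≥-K₁ : χ≥ K₁ 1
χ≥-K₁ = χ≥-complement (edgesOf (λ _ → [])) refl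

ω≤-K₁ : ω≤ K₁ 1
ω≤-K₁ = ω≤-by-check K₁ 1 refl

χ≥-C₅ : χ≥ C₅ 3
χ≥-C₅ = χ≥-complement (edgesOf cycle₅) refl

ω≤-C₅ : ω≤ C₅ 2
ω≤-C₅ = ω≤-by-check C₅ 2 refl

χ≥-R₁₇ : χ≥ R₁₇ 9
χ≥-R₁₇ = χ≥-complement (edgesOf ramsey₃₆) refl

ω≤-R₁₇ : ω≤ R₁₇ 5
ω≤-R₁₇ = ω≤-by-check R₁₇ 5 refl

witness : (s t : ℕ) → Graph (17 + (s * 5 + t * 1))
witness s t = R₁₇ ⊕ s ⊗ C₅ ⊕ t ⊗ K₁

χ≥-witness : ∀ s t → χ≥ (witness s t) (9 + (s * 3 + t * 1))
χ≥-witness s t =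
  χ≥-join R₁₇ _ χ≥-R₁₇ (χ≥-join (s ⊗ C₅) (t ⊗ K₁) (χ≥-⊗ s C₅ χ≥-C₅) (χ≥-⊗ t K₁ χ≥-K₁))

ω≤-witness : ∀ s t → ω≤ (witness s t) (5 + (s * 2 + t * 1))
ω≤-witness s t =
  ω≤-join R₁₇ _ ω≤-R₁₇ (ω≤-join (s ⊗ C₅) (t ⊗ K₁) (ω≤-⊗ s C₅ ω≤-C₅) (ω≤-⊗ t K₁ ω≤-K₁))

vertex-count : ∀ s t → 17 + (s * 5 + t * 1) ≡ 3 * s + 8 + t + 2 * s + 9
vertex-count = solve-∀

colour-count : ∀ s t → suc (3 * s + 8 + t) ≡ 9 + (s * 3 + t * 1)
colour-count = solve-∀

clique-margin : ∀ s t → 5 + (s * 2 + t * 1) < 3 * s + 8 + t ∸ s ∸ 2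
clique-margin s t = ℕ.≤-reflexive (≡-sym (begin
  3 * s + 8 + t ∸ s ∸ 2                  ≡⟨ cong (λ m → m ∸ s ∸ 2) (regroup s t) ⟩
  s + (2 + (6 + (s * 2 + t * 1))) ∸ s ∸ 2 ≡⟨ cong (_∸ 2) (ℕ.m+n∸m≡n s _) ⟩
  6 + (s * 2 + t * 1)                     ∎))
  where
  open ≡-Reasoning
  regroup : ∀ s t → 3 * s + 8 + t ≡ s + (2 + (6 + (s * 2 + t * 1)))
  regroup = solve-∀

theorem5p2 : ∀ (r s : ℕ) → r ≥ 3 * s + 8 → Fv≤ r (r ∸ s ∸ 2) (r + 2 * s + 9)
theorem5p2 r s r≥3s+8 with ℕ.m≤n⇒∃[o]m+o≡n r≥3s+8
... | t , refl =
  17 + (s * 5 + t * 1) , ℕ.≤-reflexive (vertex-count s t) , witness s t ,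
  χ≥⇒→v2 (witness s t) (χ≥-witness s t) (ℕ.≤-reflexive (colour-count s t)) ,
  ω≤⇒ω< (witness s t) (ω≤-witness s t) (clique-margin s t)
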